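{- Let $G$ be a bipartite graph with vertex classes $A$ and $B$ and let $\lambda\geq 1$. Then either (1) there is a vertex $v\in B$ and sets $A'\subset N(v)$ and $B'\subset B\setminus\{v\}$ such that $d(G[A',B'])\geq \lambda$, or (2) there is a spanning subgraph $H\subset G$ with $d(H)\geq d(G)/(\lambda+1)$ and $d_H(x,y)\leq\lambda$ for all distinct $x,y\in B$.
   Context: $d(G)=2e(G)/|V(G)|$ denotes the average degree. $N(v)$ is the neighbourhood of $v$. For disjoint vertex sets $X,Y$, $G[X,Y]$ is the bipartite subgraph of $G$ on vertex set $X\cup Y$ consisting of all edges of $G$ between $X$ and $Y$. The codegree $d_H(x,y)$ is the number of common neighbours of $x$ and $y$ in $H$.
   Formalization: The parameter λ ranges over the rationals. -}

module Defs where

open import Data.Bool using (Bool; true; false; _∧_; if_then_else_)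
open import Data.Nat using (ℕ; zero; suc; _+_; _*_)
open import Data.Fin using (Fin; _≟_)
open import Data.Fin.Subset using (Subset; _∈_; ∣_∣)
open import Data.List using (List; map; allFin)
open import Data.Nat.ListAction using (sum)
open import Data.Integer using (+_)
open import Data.Rational using (ℚ; _/_; 0ℚ)
open import Relation.Binary.PropositionalEquality using (_≡_)
open import Data.Vec using (lookup)

-- A bipartite graph with vertex classes A = Fin m and B = Fin n,
-- given by its edge indicator between the two classes.
BipGraph : ℕ → ℕ → Set
BipGraph m n = Fin m → Fin n → Bool

count : ∀ {k} → (Fin k → Bool) → ℕ
count {k} f = sum (map (λ i → if f i then 1 else 0) (allFin k))

edges : ∀ {m n} → BipGraph m n → ℕ
edges {m} {n} G = sum (map (λ a → count (λ b → G a b)) (allFin m))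

-- average degree 2e/v of a graph with e edges and v vertices
-- (convention: the graph with no vertices has average degree 0)
avgDeg : ℕ → ℕ → ℚ
avgDeg e zero    = 0ℚ
avgDeg e (suc v) = + (2 * e) / suc v

d : ∀ {m n} → BipGraph m n → ℚ
d {m} {n} G = avgDeg (edges G) (m + n)

edgesBetween : ∀ {m n} → BipGraph m n → Subset m → Subset n → ℕ
edgesBetween {m} {n} G A' B' =
  sum (map (λ a → count (λ b → lookup A' a ∧ (lookup B' b ∧ G a b))) (allFin m))

dBetween : ∀ {m n} → BipGraph m n → Subset m → Subset n → ℚ
dBetween G A' B' = avgDeg (edgesBetween G A' B') (∣ A' ∣ + ∣ B' ∣)

_⊆G_ : ∀ {m n} → BipGraph m n → BipGraph m n → Set
H ⊆G G = ∀ a b → H a b ≡ true → G a b ≡ true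

-- codegree d_H(x,y) for x,y ∈ B: number of common neighbours (all lie in A)
codeg : ∀ {m n} → BipGraph m n → Fin n → Fin n → ℕ
codeg H x y = count (λ a → H a x ∧ H a y)

module Submission where

-- Write λ = p/q and L = ⌊p/q⌋, so that L ≤ λ ≤ 2L. Run through the edges of G, adding each
-- edge ab to H unless some y ≠ b with ay ∈ H already has d_H(b,y) = L. The result H has all
-- codegrees at most L, and every edge of G − H is blocked by such a y. For y ∈ B let
-- A' = N_H(y) ⊆ N_G(y) and B' = {b ≠ y : d_H(b,y) ≥ L}; each b ∈ B' has at least L H-neighbours
-- in A', so H[A',B'] has at least L|B'| ≥ λ|B'|/2 edges, and every blocked edge ab lies in
-- G[A',B'] for its blocking y. If no y gives alternative (1), then 2e(G[A',B']) ≤ λ(|A'| + |B'|)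
-- for every y, which leaves at most λ|A'|/2 edges of G − H inside G[A',B']. Summing over y,
-- using Σ_y |A'| = e(H), gives e(G − H) ≤ λ e(H)/2, hence e(G) ≤ (λ + 1) e(H).

open import Defs
open import Data.Nat.Base using (ℕ)

module FiniteSums where
  open import Data.Bool.Base using (Bool; true; false; if_then_else_; _∧_; not)
  open import Data.Fin.Base using (Fin; zero; suc)
  import Data.Fin.Properties as Fin
  open import Data.List.Base using (map; allFin; tabulate)
  open import Data.List.Properties using (map-tabulate)
  import Data.Nat.ListAction as List
  open import Data.Nat.Base
  open import Data.Nat.Properties
  open import Function.Base using (id; _∘_)
  open import Algebra.Properties.CommutativeSemigroup +-commutativeSemigroup using (x∙yz≈y∙xz)
  open import Relation.Binary.PropositionalEquality
  open import Relation.Nullary.Negation using (¬_)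
  open import Algebra.Properties.Semiring.Sum +-*-semiring public
    using (sum; sum-syntax; sum-cong-≗; sum-replicate-zero; ∑-distrib-+; ∑-comm; *-distribˡ-sum; *-distribʳ-sum)

  listSum-allFin : ∀ {k} (f : Fin k → ℕ) → List.sum (map f (allFin k)) ≡ sum f
  listSum-allFin {k} f = trans (cong List.sum (map-tabulate id f)) (listSum-tabulate f)
    where
    listSum-tabulate : ∀ {k} (f : Fin k → ℕ) → List.sum (tabulate f) ≡ sum f
    listSum-tabulate {zero}  f = refl
    listSum-tabulate {suc k} f = cong (f zero +_) (listSum-tabulate (f ∘ suc))

  ∑-mono-≤ : ∀ {k} {f g : Fin k → ℕ} → (∀ i → f i ≤ g i) → sum f ≤ sum g
  ∑-mono-≤ {zero}  f≤g = z≤n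
  ∑-mono-≤ {suc k} f≤g = +-mono-≤ (f≤g zero) (∑-mono-≤ (f≤g ∘ suc))

  term≤sum : ∀ {k} (f : Fin k → ℕ) i → f i ≤ sum f
  term≤sum f zero    = m≤m+n _ _
  term≤sum f (suc i) = ≤-trans (term≤sum (f ∘ suc) i) (m≤n+m _ (f zero))

  ∑-mono-≤-except : ∀ {k} {f g : Fin k → ℕ} c a → (∀ i → ¬ i ≡ a → f i ≤ g i) →
                    f a ≤ c + g a → sum f ≤ c + sum g
  ∑-mono-≤-except {f = f} {g} c zero f≤g fa≤ =
    subst (sum f ≤_) (+-assoc c (g zero) _) (+-mono-≤ fa≤ (∑-mono-≤ (λ i → f≤g (suc i) λ ())))
  ∑-mono-≤-except {f = f} {g} c (suc a) f≤g fa≤ =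
    subst (sum f ≤_) (x∙yz≈y∙xz (g zero) c _)
      (+-mono-≤ (f≤g zero λ ()) (∑-mono-≤-except c a (λ i i≢a → f≤g (suc i) (i≢a ∘ Fin.suc-injective)) fa≤))

  𝟙 : Bool → ℕ
  𝟙 b = if b then 1 else 0

  count≡∑𝟙 : ∀ {k} (f : Fin k → Bool) → count f ≡ ∑[ i < k ] 𝟙 (f i)
  count≡∑𝟙 f = listSum-allFin (𝟙 ∘ f)

  𝟙-mono : ∀ {b c} → (b ≡ true → c ≡ true) → 𝟙 b ≤ 𝟙 c
  𝟙-mono {false} b⇒c = z≤n
  𝟙-mono {true}  b⇒c rewrite b⇒c refl = ≤-refl

  𝟙-∧ : ∀ b c → 𝟙 (b ∧ c) ≡ 𝟙 b * 𝟙 c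
  𝟙-∧ true  c = sym (+-identityʳ (𝟙 c))
  𝟙-∧ false c = refl

  𝟙-split : ∀ x y g h → (h ≡ true → g ≡ true) →
            𝟙 (x ∧ (y ∧ g)) ≡ 𝟙 (x ∧ (y ∧ h)) + 𝟙 (x ∧ (y ∧ (g ∧ not h)))
  𝟙-split false y     g     h     h⇒g = refl
  𝟙-split true  false g     h     h⇒g = refl
  𝟙-split true  true  g     true  h⇒g rewrite h⇒g refl = refl
  𝟙-split true  true  true  false h⇒g = refl
  𝟙-split true  true  false false h⇒g = refl

module GraphCounting where
  open FiniteSums
  open import Data.Bool.Base using (Bool; true; false; _∧_; not)
  open import Data.Bool.Properties using (∧-comm)
  open import Data.Fin.Base using (Fin)
  open import Data.Fin.Subset using (Subset; ∣_∣)
  open import Data.Nat.Base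
  open import Data.Nat.Properties
  open import Data.Product.Base using (Σ; _×_; _,_)
  open import Data.Vec.Base using ([]; _∷_; lookup; tabulate)
  open import Data.Vec.Properties using (lookup∘tabulate)
  open import Function.Base using (_∘_)
  open import Relation.Binary.PropositionalEquality

  private variable
    m n : ℕ

  _∖_ : BipGraph m n → BipGraph m n → BipGraph m n
  (G ∖ H) a b = G a b ∧ not (H a b)

  ∣∣≡∑𝟙 : ∀ {k} (A : Subset k) → ∣ A ∣ ≡ ∑[ i < k ] 𝟙 (lookup A i)
  ∣∣≡∑𝟙 []          = refl
  ∣∣≡∑𝟙 (true  ∷ A) = cong suc (∣∣≡∑𝟙 A)
  ∣∣≡∑𝟙 (false ∷ A) = ∣∣≡∑𝟙 A

  edges≡∑∑ : (F : BipGraph m n) → edges F ≡ ∑[ a < m ] ∑[ b < n ] 𝟙 (F a b)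
  edges≡∑∑ F = trans (listSum-allFin (count ∘ F)) (sum-cong-≗ (count≡∑𝟙 ∘ F))

  edgesBetween≡∑∑ : (F : BipGraph m n) (A : Subset m) (B : Subset n) →
    edgesBetween F A B ≡ ∑[ a < m ] ∑[ b < n ] 𝟙 (lookup A a ∧ (lookup B b ∧ F a b))
  edgesBetween≡∑∑ {m} {n} F A B = trans (listSum-allFin λ a → count (row a)) (sum-cong-≗ (count≡∑𝟙 ∘ row))
    where
    row : Fin m → Fin n → Bool
    row a b = lookup A a ∧ (lookup B b ∧ F a b)

  ∑∑-split : ∀ {f g h : Fin m → Fin n → ℕ} → (∀ a b → f a b ≡ g a b + h a b) →
    ∑[ a < m ] ∑[ b < n ] f a b ≡ ∑[ a < m ] ∑[ b < n ] g a b + ∑[ a < m ] ∑[ b < n ] h a b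
  ∑∑-split {g = g} {h} f≡g+h = trans
    (sum-cong-≗ λ a → trans (sum-cong-≗ (f≡g+h a)) (∑-distrib-+ (g a) (h a)))
    (∑-distrib-+ (λ a → sum (g a)) (λ a → sum (h a)))

  edges-∖ : {G H : BipGraph m n} → H ⊆G G → edges G ≡ edges H + edges (G ∖ H)
  edges-∖ {G = G} {H} H⊆G = begin
    edges G                                             ≡⟨ edges≡∑∑ G ⟩
    ∑[ a < _ ] ∑[ b < _ ] 𝟙 (G a b)                     ≡⟨ ∑∑-split (λ a b → 𝟙-split true true (G a b) (H a b) (H⊆G a b)) ⟩
    ∑[ a < _ ] ∑[ b < _ ] 𝟙 (H a b) + ∑[ a < _ ] ∑[ b < _ ] 𝟙 ((G ∖ H) a b)
                                                        ≡⟨ sym (cong₂ _+_ (edges≡∑∑ H) (edges≡∑∑ (G ∖ H))) ⟩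
    edges H + edges (G ∖ H)                             ∎
    where open ≡-Reasoning

  edgesBetween-∖ : {G H : BipGraph m n} → H ⊆G G → ∀ A B →
    edgesBetween G A B ≡ edgesBetween H A B + edgesBetween (G ∖ H) A B
  edgesBetween-∖ {G = G} {H} H⊆G A B = begin
    edgesBetween G A B                                  ≡⟨ edgesBetween≡∑∑ G A B ⟩
    ∑[ a < _ ] ∑[ b < _ ] 𝟙 (lookup A a ∧ (lookup B b ∧ G a b))
      ≡⟨ ∑∑-split (λ a b → 𝟙-split (lookup A a) (lookup B b) (G a b) (H a b) (H⊆G a b)) ⟩
    ∑[ a < _ ] ∑[ b < _ ] 𝟙 (lookup A a ∧ (lookup B b ∧ H a b)) +
    ∑[ a < _ ] ∑[ b < _ ] 𝟙 (lookup A a ∧ (lookup B b ∧ (G ∖ H) a b))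
      ≡⟨ sym (cong₂ _+_ (edgesBetween≡∑∑ H A B) (edgesBetween≡∑∑ (G ∖ H) A B)) ⟩
    edgesBetween H A B + edgesBetween (G ∖ H) A B       ∎
    where open ≡-Reasoning

  edgesBetween≤∣∣*∣∣ : (F : BipGraph m n) (A : Subset m) (B : Subset n) →
                       edgesBetween F A B ≤ ∣ A ∣ * ∣ B ∣
  edgesBetween≤∣∣*∣∣ {m} {n} F A B = begin
    edgesBetween F A B                                  ≡⟨ edgesBetween≡∑∑ F A B ⟩
    ∑[ a < m ] ∑[ b < n ] 𝟙 (lookup A a ∧ (lookup B b ∧ F a b))
      ≤⟨ ∑-mono-≤ (λ a → ∑-mono-≤ λ b → 𝟙∧∧≤𝟙*𝟙 (lookup A a) (lookup B b) (F a b)) ⟩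
    ∑[ a < m ] ∑[ b < n ] (𝟙 (lookup A a) * 𝟙 (lookup B b))
      ≡⟨ sum-cong-≗ (λ a → sym (*-distribˡ-sum (𝟙 (lookup A a)) (𝟙 ∘ lookup B))) ⟩
    ∑[ a < m ] (𝟙 (lookup A a) * ∑[ b < n ] 𝟙 (lookup B b))
      ≡⟨ sym (*-distribʳ-sum (sum (𝟙 ∘ lookup B)) (𝟙 ∘ lookup A)) ⟩
    ∑[ a < m ] 𝟙 (lookup A a) * ∑[ b < n ] 𝟙 (lookup B b)
      ≡⟨ sym (cong₂ _*_ (∣∣≡∑𝟙 A) (∣∣≡∑𝟙 B)) ⟩
    ∣ A ∣ * ∣ B ∣                                       ∎
    where
    open ≤-Reasoning
    𝟙∧∧≤𝟙*𝟙 : ∀ x y z → 𝟙 (x ∧ (y ∧ z)) ≤ 𝟙 x * 𝟙 y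
    𝟙∧∧≤𝟙*𝟙 x y z = ≤-trans (𝟙-mono {x ∧ (y ∧ z)} {x ∧ y} (mono x y z)) (≤-reflexive (𝟙-∧ x y))
      where
      mono : ∀ x y z → x ∧ (y ∧ z) ≡ true → x ∧ y ≡ true
      mono true true z _ = refl

  count-cong : ∀ {k} {f g : Fin k → Bool} → (∀ i → f i ≡ g i) → count f ≡ count g
  count-cong {f = f} {g} f≗g = trans (count≡∑𝟙 f) (trans (sum-cong-≗ (cong 𝟙 ∘ f≗g)) (sym (count≡∑𝟙 g)))

  codeg-sym : (H : BipGraph m n) → ∀ x y → codeg H x y ≡ codeg H y x
  codeg-sym H x y = begin
    codeg H x y                          ≡⟨ count≡∑𝟙 (λ a → H a x ∧ H a y) ⟩
    ∑[ a < _ ] 𝟙 (H a x ∧ H a y)         ≡⟨ sum-cong-≗ (λ a → cong 𝟙 (∧-comm (H a x) (H a y))) ⟩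
    ∑[ a < _ ] 𝟙 (H a y ∧ H a x)         ≡⟨ count≡∑𝟙 (λ a → H a y ∧ H a x) ⟨
    codeg H y x                          ∎
    where open ≡-Reasoning

  codeg-mono : {H₁ H₂ : BipGraph m n} → H₁ ⊆G H₂ → ∀ x y → codeg H₁ x y ≤ codeg H₂ x y
  codeg-mono {H₁ = H₁} {H₂} H₁⊆H₂ x y = begin
    codeg H₁ x y                         ≡⟨ count≡∑𝟙 (λ a → H₁ a x ∧ H₁ a y) ⟩
    ∑[ a < _ ] 𝟙 (H₁ a x ∧ H₁ a y)       ≤⟨ ∑-mono-≤ (λ a → 𝟙-mono (common a (H₁ a x) (H₁ a y) refl refl)) ⟩
    ∑[ a < _ ] 𝟙 (H₂ a x ∧ H₂ a y)       ≡⟨ count≡∑𝟙 (λ a → H₂ a x ∧ H₂ a y) ⟨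
    codeg H₂ x y                         ∎
    where
    open ≤-Reasoning
    common : ∀ a u v → H₁ a x ≡ u → H₁ a y ≡ v → u ∧ v ≡ true → H₂ a x ∧ H₂ a y ≡ true
    common a true true ax ay _ = cong₂ _∧_ (H₁⊆H₂ a x ax) (H₁⊆H₂ a y ay)

  neighbourhood : BipGraph m n → Fin n → Subset m
  neighbourhood F y = tabulate (λ a → F a y)

  ∑∣neighbourhood∣≡edges : (F : BipGraph m n) → ∑[ y < n ] ∣ neighbourhood F y ∣ ≡ edges F
  ∑∣neighbourhood∣≡edges {m} {n} F = begin
    ∑[ y < n ] ∣ neighbourhood F y ∣     ≡⟨ sum-cong-≗ (λ y → trans (∣∣≡∑𝟙 (neighbourhood F y))
                                              (sum-cong-≗ λ a → cong 𝟙 (lookup∘tabulate (λ a → F a y) a))) ⟩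
    ∑[ y < n ] ∑[ a < m ] 𝟙 (F a y)      ≡⟨ ∑-comm (λ y a → 𝟙 (F a y)) ⟩
    ∑[ a < m ] ∑[ y < n ] 𝟙 (F a y)      ≡⟨ edges≡∑∑ F ⟨
    edges F                              ∎
    where open ≡-Reasoning

  *∣∣≤edgesBetween : ∀ L (F : BipGraph m n) A B →
    (∀ b → lookup B b ≡ true → L ≤ count (λ a → lookup A a ∧ F a b)) →
    L * ∣ B ∣ ≤ edgesBetween F A B
  *∣∣≤edgesBetween {m} {n} L F A B degree≥ = begin
    L * ∣ B ∣                            ≡⟨ cong (L *_) (∣∣≡∑𝟙 B) ⟩
    L * ∑[ b < n ] 𝟙 (lookup B b)        ≡⟨ *-distribˡ-sum L (𝟙 ∘ lookup B) ⟩
    ∑[ b < n ] (L * 𝟙 (lookup B b))      ≤⟨ ∑-mono-≤ column ⟩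
    ∑[ b < n ] ∑[ a < m ] 𝟙 (lookup A a ∧ (lookup B b ∧ F a b))
                                         ≡⟨ ∑-comm (λ b a → 𝟙 (lookup A a ∧ (lookup B b ∧ F a b))) ⟩
    ∑[ a < m ] ∑[ b < n ] 𝟙 (lookup A a ∧ (lookup B b ∧ F a b))
                                         ≡⟨ edgesBetween≡∑∑ F A B ⟨
    edgesBetween F A B                   ∎
    where
    open ≤-Reasoning
    column : ∀ b → L * 𝟙 (lookup B b) ≤ ∑[ a < m ] 𝟙 (lookup A a ∧ (lookup B b ∧ F a b))
    column b with lookup B b in b∈B
    ... | false = ≤-trans (≤-reflexive (*-zeroʳ L)) z≤n
    ... | true  = subst₂ _≤_ (sym (*-identityʳ L)) (count≡∑𝟙 (λ a → lookup A a ∧ F a b)) (degree≥ b b∈B)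

  edges≤∑edgesBetween : ∀ {k} (F : BipGraph m n) (A : Fin k → Subset m) (B : Fin k → Subset n) →
    (∀ a b → F a b ≡ true → Σ (Fin k) λ y → lookup (A y) a ≡ true × lookup (B y) b ≡ true) →
    edges F ≤ ∑[ y < k ] edgesBetween F (A y) (B y)
  edges≤∑edgesBetween {m} {n} {k} F A B cover = begin
    edges F                              ≡⟨ edges≡∑∑ F ⟩
    ∑[ a < m ] ∑[ b < n ] 𝟙 (F a b)      ≤⟨ ∑-mono-≤ (λ a → ∑-mono-≤ (covered a)) ⟩
    ∑[ a < m ] ∑[ b < n ] ∑[ y < k ] term y a b
                                         ≡⟨ sum-cong-≗ (λ a → ∑-comm (λ b y → term y a b)) ⟩
    ∑[ a < m ] ∑[ y < k ] ∑[ b < n ] term y a b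
                                         ≡⟨ ∑-comm (λ a y → ∑[ b < n ] term y a b) ⟩
    ∑[ y < k ] ∑[ a < m ] ∑[ b < n ] term y a b
                                         ≡⟨ sum-cong-≗ (λ y → edgesBetween≡∑∑ F (A y) (B y)) ⟨
    ∑[ y < k ] edgesBetween F (A y) (B y) ∎
    where
    open ≤-Reasoning
    term : Fin k → Fin m → Fin n → ℕ
    term y a b = 𝟙 (lookup (A y) a ∧ (lookup (B y) b ∧ F a b))
    covered : ∀ a b → 𝟙 (F a b) ≤ ∑[ y < k ] term y a b
    covered a b with F a b in ab∈F
    ... | false = z≤n
    ... | true with cover a b ab∈F
    ...   | y , a∈A , b∈B = ≤-trans (𝟙-mono {true} (λ _ → cong₂ _∧_ a∈A (cong₂ _∧_ b∈B refl)))
                                     (term≤sum (λ y → 𝟙 (lookup (A y) a ∧ (lookup (B y) b ∧ true))) y)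

module GreedySaturation {m n : ℕ} (G : BipGraph m n) (L : ℕ) where
  open FiniteSums
  open GraphCounting using (codeg-mono; codeg-sym)
  open import Data.Bool.Base using (true; false; _∧_; _∨_)
  import Data.Bool.Properties as Bool
  open import Data.Fin.Base using (Fin)
  open import Data.Fin.Properties using (_≟_; any?)
  open import Data.List.Base using (List; []; _∷_; foldl; allFin; cartesianProduct)
  open import Data.List.Membership.Propositional using (_∈_)
  open import Data.List.Membership.Propositional.Properties using (∈-cartesianProduct⁺; ∈-allFin)
  open import Data.List.Relation.Unary.Any using (here; there)
  open import Data.Nat.Base using (_≤_; _+_; z≤n)
  open import Data.Nat.Properties using (≤-trans; ≤-refl; m≤m+n; ≰⇒>; _≤?_)
  open import Data.Product.Base using (Σ; _×_; _,_)
  open import Function.Base using (_∘_)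
  open import Relation.Binary.PropositionalEquality
  open import Relation.Nullary.Decidable using (Dec; yes; no; does; ¬?; _×-dec_; dec-true; dec-false)
  open import Relation.Nullary.Negation using (¬_; contradiction)

  CodegreeBounded : BipGraph m n → Set
  CodegreeBounded H = ∀ x y → ¬ x ≡ y → codeg H x y ≤ L

  Admissible : BipGraph m n → Set
  Admissible H = H ⊆G G × CodegreeBounded H

  -- Adding ab to H would make a a new common neighbour of b and some y already at codegree L.
  Blocked : BipGraph m n → Fin m → Fin n → Set
  Blocked H a b = Σ (Fin n) λ y → ¬ y ≡ b × H a y ≡ true × L ≤ codeg H b y

  blocked? : ∀ H a b → Dec (Blocked H a b)
  blocked? H a b = any? λ y → ¬? (y ≟ b) ×-dec (H a y Bool.≟ true) ×-dec (L ≤? codeg H b y)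

  Settled : Fin m × Fin n → BipGraph m n → Set
  Settled (a , b) H = G a b ≡ true → H a b ≡ false → Blocked H a b

  addEdge : BipGraph m n → Fin m → Fin n → BipGraph m n
  addEdge H a b a' b' = (does (a' ≟ a) ∧ does (b' ≟ b)) ∨ H a' b'

  addEdge-self : ∀ H a b → addEdge H a b a b ≡ true
  addEdge-self H a b rewrite dec-true (a ≟ a) refl | dec-true (b ≟ b) refl = refl

  ⊆-addEdge : ∀ H a b → H ⊆G addEdge H a b
  ⊆-addEdge H a b a' b' e = trans (cong (does (a' ≟ a) ∧ does (b' ≟ b) ∨_) e) (Bool.∨-zeroʳ _)

  addEdge-otherˡ : ∀ H a b a' b' → ¬ a' ≡ a → addEdge H a b a' b' ≡ H a' b'
  addEdge-otherˡ H a b a' b' a'≢a rewrite dec-false (a' ≟ a) a'≢a = refl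

  addEdge-otherʳ : ∀ H a b a' b' → ¬ b' ≡ b → addEdge H a b a' b' ≡ H a' b'
  addEdge-otherʳ H a b a' b' b'≢b rewrite dec-false (b' ≟ b) b'≢b | Bool.∧-zeroʳ (does (a' ≟ a)) = refl

  addEdge-⊆ : ∀ {H} a b → H ⊆G G → G a b ≡ true → addEdge H a b ⊆G G
  addEdge-⊆ a b H⊆G ab∈G a' b' e with a' ≟ a | b' ≟ b
  ... | yes refl | yes refl = ab∈G
  ... | yes _    | no _     = H⊆G a' b' e
  ... | no _     | _        = H⊆G a' b' e

  codeg-addEdge-away : ∀ H a b x y → ¬ x ≡ b → ¬ y ≡ b → codeg (addEdge H a b) x y ≡ codeg H x y
  codeg-addEdge-away H a b x y x≢b y≢b = begin
    codeg (addEdge H a b) x y                   ≡⟨ count≡∑𝟙 (λ a' → addEdge H a b a' x ∧ addEdge H a b a' y) ⟩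
    sum (λ a' → 𝟙 (addEdge H a b a' x ∧ addEdge H a b a' y))
      ≡⟨ sum-cong-≗ (λ a' → cong₂ (λ u v → 𝟙 (u ∧ v)) (unchanged a' x x≢b) (unchanged a' y y≢b)) ⟩
    sum (λ a' → 𝟙 (H a' x ∧ H a' y))           ≡⟨ count≡∑𝟙 (λ a' → H a' x ∧ H a' y) ⟨
    codeg H x y                                 ∎
    where
    open ≡-Reasoning
    unchanged : ∀ a' c → ¬ c ≡ b → addEdge H a b a' c ≡ H a' c
    unchanged a' c = addEdge-otherʳ H a b a' c

  codeg-addEdge≤ : ∀ H a b y → ¬ y ≡ b → codeg (addEdge H a b) b y ≤ 𝟙 (H a y) + codeg H b y
  codeg-addEdge≤ H a b y y≢b = subst₂ _≤_
    (sym (count≡∑𝟙 (λ a' → addEdge H a b a' b ∧ addEdge H a b a' y)))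
    (cong (𝟙 (H a y) +_) (sym (count≡∑𝟙 (λ a' → H a' b ∧ H a' y))))
    (∑-mono-≤-except (𝟙 (H a y)) a unchanged at-a)
    where
    unchanged : ∀ a' → ¬ a' ≡ a → 𝟙 (addEdge H a b a' b ∧ addEdge H a b a' y) ≤ 𝟙 (H a' b ∧ H a' y)
    unchanged a' a'≢a rewrite addEdge-otherˡ H a b a' b a'≢a | addEdge-otherˡ H a b a' y a'≢a = ≤-refl
    at-a : 𝟙 (addEdge H a b a b ∧ addEdge H a b a y) ≤ 𝟙 (H a y) + 𝟙 (H a b ∧ H a y)
    at-a rewrite addEdge-self H a b | addEdge-otherʳ H a b a y y≢b = m≤m+n _ _

  addEdge-codegreeBounded-at : ∀ {H} a b → CodegreeBounded H → ¬ Blocked H a b →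
                               ∀ y → ¬ y ≡ b → codeg (addEdge H a b) b y ≤ L
  addEdge-codegreeBounded-at {H} a b bounded unblocked y y≢b =
    ≤-trans (codeg-addEdge≤ H a b y y≢b) (bound (H a y) refl)
    where
    bound : ∀ h → H a y ≡ h → 𝟙 h + codeg H b y ≤ L
    bound true  ay = ≰⇒> λ L≤ → unblocked (y , y≢b , ay , L≤)
    bound false _  = bounded b y (y≢b ∘ sym)

  addEdge-codegreeBounded : ∀ {H} a b → CodegreeBounded H → ¬ Blocked H a b →
                            CodegreeBounded (addEdge H a b)
  addEdge-codegreeBounded {H} a b bounded unblocked x y x≢y = bound (x ≟ b) (y ≟ b)
    where
    bound : Dec (x ≡ b) → Dec (y ≡ b) → codeg (addEdge H a b) x y ≤ L
    bound (yes x≡b) (yes y≡b) = contradiction (trans x≡b (sym y≡b)) x≢y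
    bound (yes x≡b) (no y≢b)  = subst (λ x → codeg (addEdge H a b) x y ≤ L) (sym x≡b)
                                  (addEdge-codegreeBounded-at a b bounded unblocked y y≢b)
    bound (no x≢b)  (yes y≡b) = subst (λ y → codeg (addEdge H a b) x y ≤ L) (sym y≡b)
                                  (subst (_≤ L) (codeg-sym (addEdge H a b) b x)
                                    (addEdge-codegreeBounded-at a b bounded unblocked x x≢b))
    bound (no x≢b)  (no y≢b)  = subst (_≤ L) (sym (codeg-addEdge-away H a b x y x≢b y≢b))
                                  (bounded x y x≢y)

  step : BipGraph m n → Fin m × Fin n → BipGraph m n
  step H (a , b) with G a b | blocked? H a b
  ... | true | no _ = addEdge H a b
  ... | _    | _    = H

  step-admissible : ∀ {H} p → Admissible H → Admissible (step H p)
  step-admissible {H} (a , b) (H⊆G , bounded) with G a b in ab∈G | blocked? H a b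
  ... | true  | no unblocked = addEdge-⊆ a b H⊆G ab∈G , addEdge-codegreeBounded a b bounded unblocked
  ... | true  | yes _        = H⊆G , bounded
  ... | false | _            = H⊆G , bounded

  ⊆-step : ∀ H p → H ⊆G step H p
  ⊆-step H (a , b) with G a b | blocked? H a b
  ... | true  | no _  = ⊆-addEdge H a b
  ... | true  | yes _ = λ _ _ e → e
  ... | false | _     = λ _ _ e → e

  step-settles : ∀ H p → Settled p (step H p)
  step-settles H (a , b) with G a b | blocked? H a b
  ... | true  | no _    = λ _ ab∉H → contradiction (trans (sym (addEdge-self H a b)) ab∉H) λ ()
  ... | true  | yes blk = λ _ _ → blk
  ... | false | _       = λ ()

  settled-mono : ∀ {H₁ H₂} p → H₁ ⊆G H₂ → Settled p H₁ → Settled p H₂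
  settled-mono {H₁} {H₂} (a , b) H₁⊆H₂ settled ab∈G ab∉H₂ with H₁ a b in ab∈H₁
  ... | true  = contradiction (trans (sym (H₁⊆H₂ a b ab∈H₁)) ab∉H₂) λ ()
  ... | false with settled ab∈G refl
  ...   | y , y≢b , ay∈H₁ , L≤ = y , y≢b , H₁⊆H₂ a y ay∈H₁ , ≤-trans L≤ (codeg-mono H₁⊆H₂ b y)

  foldl-admissible : ∀ ps {H} → Admissible H → Admissible (foldl step H ps)
  foldl-admissible []       adm = adm
  foldl-admissible (p ∷ ps) adm = foldl-admissible ps (step-admissible p adm)

  ⊆-foldl : ∀ ps H → H ⊆G foldl step H ps
  ⊆-foldl []       H a b e = e
  ⊆-foldl (p ∷ ps) H a b e = ⊆-foldl ps (step H p) a b (⊆-step H p a b e)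

  foldl-settles : ∀ ps H {p} → p ∈ ps → Settled p (foldl step H ps)
  foldl-settles (p ∷ ps) H (here refl) = settled-mono p (⊆-foldl ps (step H p)) (step-settles H p)
  foldl-settles (_ ∷ ps) H (there p∈ps) = foldl-settles ps _ p∈ps

  ∅ : BipGraph m n
  ∅ _ _ = false

  ∅-admissible : Admissible ∅
  ∅-admissible = (λ _ _ ()) , λ x y _ →
    subst (_≤ L) (sym (trans (count≡∑𝟙 {m} λ _ → false) (sum-replicate-zero m))) z≤n

  saturatedSubgraph : Σ (BipGraph m n) λ H → Admissible H × (∀ a b → Settled (a , b) H)
  saturatedSubgraph =
    foldl step ∅ pairs ,
    foldl-admissible pairs ∅-admissible ,
    λ a b → foldl-settles pairs ∅ (∈-cartesianProduct⁺ (∈-allFin a) (∈-allFin b))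
    where
    pairs : List (Fin m × Fin n)
    pairs = cartesianProduct (allFin m) (allFin n)

module NatArithmetic where
  open import Data.Nat.Base
  open import Data.Nat.DivMod using (m≡m%n+[m/n]*n; m%n<n; m≥n⇒m/n>0)
  open import Data.Nat.Properties
  open import Data.Nat.Tactic.RingSolver using (solve-∀)
  open import Relation.Binary.PropositionalEquality

  m≤2*[m/n]*n : ∀ m n .{{_ : NonZero n}} → n ≤ m → m ≤ 2 * (m / n) * n
  m≤2*[m/n]*n m n n≤m = begin
    m                              ≡⟨ m≡m%n+[m/n]*n m n ⟩
    m % n + m / n * n              ≤⟨ +-monoˡ-≤ (m / n * n) (<⇒≤ (m%n<n m n)) ⟩
    n + m / n * n                  ≤⟨ +-monoˡ-≤ (m / n * n) n≤[m/n]*n ⟩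
    m / n * n + m / n * n          ≡⟨ double (m / n) n ⟩
    2 * (m / n) * n                ∎
    where
    open ≤-Reasoning
    n≤[m/n]*n : n ≤ m / n * n
    n≤[m/n]*n = subst (_≤ m / n * n) (*-identityˡ n) (*-monoˡ-≤ n (m≥n⇒m/n>0 n≤m))
    double : ∀ x y → x * y + x * y ≡ 2 * x * y
    double = solve-∀

  2*q*D≤p*A : ∀ {p q L A B X D} → 2 * (X + D) * q ≤ p * (A + B) → L * B ≤ X → p ≤ 2 * L * q →
              2 * q * D ≤ p * A
  2*q*D≤p*A {p} {q} {L} {A} {B} {X} {D} total≤ L*B≤X p≤2Lq = +-cancelˡ-≤ (2 * q * X) _ _ (begin
    2 * q * X + 2 * q * D          ≡⟨ regroupˡ q X D ⟩
    2 * (X + D) * q                ≤⟨ total≤ ⟩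
    p * (A + B)                    ≡⟨ *-distribˡ-+ p A B ⟩
    p * A + p * B                  ≤⟨ +-monoʳ-≤ (p * A) (*-monoˡ-≤ B p≤2Lq) ⟩
    p * A + 2 * L * q * B          ≡⟨ cong (p * A +_) (regroupʳ L q B) ⟩
    p * A + 2 * q * (L * B)        ≤⟨ +-monoʳ-≤ (p * A) (*-monoʳ-≤ (2 * q) L*B≤X) ⟩
    p * A + 2 * q * X              ≡⟨ +-comm (p * A) (2 * q * X) ⟩
    2 * q * X + p * A              ∎)
    where
    open ≤-Reasoning
    regroupˡ : ∀ q X D → 2 * q * X + 2 * q * D ≡ 2 * (X + D) * q
    regroupˡ = solve-∀
    regroupʳ : ∀ L q B → 2 * L * q * B ≡ 2 * q * (L * B)
    regroupʳ = solve-∀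

module SaturatedSubgraph {m n : ℕ} (G : BipGraph m n) (L : ℕ) where
  open FiniteSums
  open GraphCounting
  open NatArithmetic using (2*q*D≤p*A)
  open GreedySaturation G L using (saturatedSubgraph; CodegreeBounded; Settled)
  open import Data.Bool.Base using (true; false; _∧_)
  open import Data.Fin.Base using (Fin)
  open import Data.Fin.Properties using (_≟_)
  open import Data.Fin.Subset using (Subset; _∈_; _∉_; ∣_∣)
  open import Data.Nat.Base
  open import Data.Nat.Properties hiding (_≟_)
  open import Data.Product.Base using (Σ; _×_; _,_; proj₁; proj₂)
  open import Data.Vec.Base using (tabulate; lookup)
  open import Data.Vec.Properties using (lookup∘tabulate; []=⇒lookup)
  open import Relation.Binary.PropositionalEquality
  open import Relation.Nullary.Decidable using (Dec; does; proof; dec-true; ¬?; _×-dec_)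
  open import Relation.Nullary.Reflects using (Reflects; invert)
  open import Function.Base using (_∘_)
  open import Function.Bundles using (_⇔_; mk⇔; Equivalence)
  open import Relation.Nullary.Negation using (¬_)

  H : BipGraph m n
  H = proj₁ saturatedSubgraph

  H⊆G : H ⊆G G
  H⊆G = proj₁ (proj₁ (proj₂ saturatedSubgraph))

  H-codegreeBounded : CodegreeBounded H
  H-codegreeBounded = proj₂ (proj₁ (proj₂ saturatedSubgraph))

  H-settled : ∀ a b → Settled (a , b) H
  H-settled = proj₂ (proj₂ saturatedSubgraph)

  A : Fin n → Subset m
  A = neighbourhood H

  B : Fin n → Subset n
  B y = tabulate λ b → does (¬? (b ≟ y) ×-dec (L ≤? codeg H b y))

  lookup-A : ∀ y a → lookup (A y) a ≡ H a y
  lookup-A y a = lookup∘tabulate (λ a → H a y) a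

  lookup-B : ∀ y b → lookup (B y) b ≡ true ⇔ (¬ b ≡ y × L ≤ codeg H b y)
  lookup-B y b = mk⇔
    (λ b∈B → invert (subst (Reflects _) (trans (sym (lookup∘tabulate _ b)) b∈B) (proof b∈B?)))
    (λ b∈B → trans (lookup∘tabulate _ b) (dec-true b∈B? b∈B))
    where
    b∈B? : Dec (¬ b ≡ y × L ≤ codeg H b y)
    b∈B? = ¬? (b ≟ y) ×-dec (L ≤? codeg H b y)

  A⊆N : ∀ y a → a ∈ A y → G a y ≡ true
  A⊆N y a a∈A = H⊆G a y (trans (sym (lookup-A y a)) ([]=⇒lookup a∈A))

  y∉B : ∀ y → y ∉ B y
  y∉B y y∈B = proj₁ (Equivalence.to (lookup-B y y) ([]=⇒lookup y∈B)) refl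

  L*∣B∣≤edgesBetween : ∀ y → L * ∣ B y ∣ ≤ edgesBetween H (A y) (B y)
  L*∣B∣≤edgesBetween y = *∣∣≤edgesBetween L H (A y) (B y) λ b b∈B →
    subst (L ≤_) (trans (codeg-sym H b y) (count-cong λ a → cong (_∧ H a b) (sym (lookup-A y a))))
      (proj₂ (Equivalence.to (lookup-B y b) b∈B))

  missing≤∑edgesBetween : edges (G ∖ H) ≤ ∑[ y < n ] edgesBetween (G ∖ H) (A y) (B y)
  missing≤∑edgesBetween = edges≤∑edgesBetween (G ∖ H) A B cover
    where
    cover : ∀ a b → (G ∖ H) a b ≡ true → Σ (Fin n) λ y → lookup (A y) a ≡ true × lookup (B y) b ≡ true
    cover a b ab∈G∖H with G a b in ab∈G | H a b in ab∈H
    cover a b ()     | false | _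
    cover a b ()     | true  | true
    cover a b _      | true  | false with H-settled a b ab∈G ab∈H
    ... | y , y≢b , ay∈H , L≤codeg =
      y , trans (lookup-A y a) ay∈H , Equivalence.from (lookup-B y b) ((y≢b ∘ sym) , L≤codeg)

  sparse⇒q*edges≤[p+q]*edges : ∀ p q → p ≤ 2 * L * q →
    (∀ y → 2 * edgesBetween G (A y) (B y) * q ≤ p * (∣ A y ∣ + ∣ B y ∣)) →
    q * edges G ≤ (p + q) * edges H
  sparse⇒q*edges≤[p+q]*edges p q p≤2Lq sparse = begin
    q * edges G                         ≡⟨ cong (q *_) (edges-∖ H⊆G) ⟩
    q * (edges H + edges (G ∖ H))       ≡⟨ *-distribˡ-+ q (edges H) (edges (G ∖ H)) ⟩
    q * edges H + q * edges (G ∖ H)     ≤⟨ +-monoʳ-≤ (q * edges H) (*-monoˡ-≤ (edges (G ∖ H)) (m≤n*m q 2)) ⟩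
    q * edges H + 2 * q * edges (G ∖ H) ≤⟨ +-monoʳ-≤ (q * edges H) missing ⟩
    q * edges H + p * edges H           ≡⟨ *-distribʳ-+ (edges H) q p ⟨
    (q + p) * edges H                   ≡⟨ cong (_* edges H) (+-comm q p) ⟩
    (p + q) * edges H                   ∎
    where
    open ≤-Reasoning
    D : Fin n → ℕ
    D y = edgesBetween (G ∖ H) (A y) (B y)
    per-vertex : ∀ y → 2 * q * D y ≤ p * ∣ A y ∣
    per-vertex y = 2*q*D≤p*A {L = L}
      (subst (λ e → 2 * e * q ≤ p * (∣ A y ∣ + ∣ B y ∣)) (edgesBetween-∖ H⊆G (A y) (B y)) (sparse y))
      (L*∣B∣≤edgesBetween y) p≤2Lq
    missing : 2 * q * edges (G ∖ H) ≤ p * edges H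
    missing = begin
      2 * q * edges (G ∖ H)             ≤⟨ *-monoʳ-≤ (2 * q) missing≤∑edgesBetween ⟩
      2 * q * ∑[ y < n ] D y            ≡⟨ *-distribˡ-sum (2 * q) D ⟩
      ∑[ y < n ] (2 * q * D y)          ≤⟨ ∑-mono-≤ per-vertex ⟩
      ∑[ y < n ] (p * ∣ A y ∣)          ≡⟨ *-distribˡ-sum p (λ y → ∣ A y ∣) ⟨
      p * ∑[ y < n ] ∣ A y ∣            ≡⟨ cong (p *_) (∑∣neighbourhood∣≡edges H) ⟩
      p * edges H                       ∎

module AverageDegree where
  open import Data.Integer.Base as ℤ using (+_)
  import Data.Integer.Properties as ℤ
  open import Data.Nat.Base hiding (_/_)
  open import Data.Nat.Properties
    using (+-identityʳ; *-identityʳ; *-monoʳ-≤; ≤-trans; ≤-reflexive; n≤0⇒n≡0; m+n≡0⇒m≡0)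
  open import Data.Fin.Subset using (∣_∣)
  open GraphCounting using (edgesBetween≤∣∣*∣∣)
  open import Data.Nat.Tactic.RingSolver using (solve-∀)
  open import Data.Rational.Base as ℚ using (ℚ; toℚᵘ; 1ℚ; _/_)
  import Data.Rational.Properties as ℚ
  open import Data.Rational.Unnormalised.Base as ℚᵘ using (mkℚᵘ; *≤*; _≃_; 1ℚᵘ)
  import Data.Rational.Unnormalised.Properties as ℚᵘ
  open import Function.Bundles using (_⇔_; mk⇔; Equivalence)
  open import Relation.Nullary.Negation using (¬_)
  open import Relation.Binary.PropositionalEquality

  mkℚᵘ-≤⇔ : ∀ {a k b l} → mkℚᵘ (+ a) k ℚᵘ.≤ mkℚᵘ (+ b) l ⇔ a * suc l ≤ b * suc k
  mkℚᵘ-≤⇔ {a} {k} {b} {l} = mk⇔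
    (λ { (*≤* ≤ℤ) → ℤ.drop‿+≤+ (subst₂ ℤ._≤_ (sym (ℤ.pos-* a (suc l))) (sym (ℤ.pos-* b (suc k))) ≤ℤ) })
    (λ ≤ℕ → *≤* (subst₂ ℤ._≤_ (ℤ.pos-* a (suc l)) (ℤ.pos-* b (suc k)) (ℤ.+≤+ ≤ℕ)))

  ≤⇔*≤* : ∀ {x y : ℚ} {a k b l} → toℚᵘ x ≃ mkℚᵘ (+ a) k → toℚᵘ y ≃ mkℚᵘ (+ b) l →
          x ℚ.≤ y ⇔ a * suc l ≤ b * suc k
  ≤⇔*≤* x≃ y≃ = mk⇔
    (λ x≤y → to (ℚᵘ.≤-respˡ-≃ x≃ (ℚᵘ.≤-respʳ-≃ y≃ (ℚ.toℚᵘ-mono-≤ x≤y))))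
    (λ ≤ℕ → ℚ.toℚᵘ-cancel-≤ (ℚᵘ.≤-respˡ-≃ (ℚᵘ.≃-sym x≃) (ℚᵘ.≤-respʳ-≃ (ℚᵘ.≃-sym y≃) (from ≤ℕ))))
    where open Equivalence mkℚᵘ-≤⇔

  avgDeg-≃ : ∀ e s → toℚᵘ (avgDeg e (suc s)) ≃ mkℚᵘ (+ (2 * e)) s
  avgDeg-≃ e s = ℚ.toℚᵘ-fromℚᵘ (mkℚᵘ (+ (2 * e)) s)

  mkℚᵘ-* : ∀ a k b l → mkℚᵘ (+ a) k ℚᵘ.* mkℚᵘ (+ b) l ≃ mkℚᵘ (+ (a * b)) (l + k * suc l)
  mkℚᵘ-* a k b l = ℚᵘ.≃-reflexive (cong (λ z → mkℚᵘ z (l + k * suc l)) (sym (ℤ.pos-* a b)))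

  mkℚᵘ-+1 : ∀ p l → mkℚᵘ (+ p) l ℚᵘ.+ 1ℚᵘ ≃ mkℚᵘ (+ (p + suc l)) l
  mkℚᵘ-+1 p l = ℚᵘ.≃-reflexive (cong₂ mkℚᵘ
    (trans (cong₂ ℤ._+_ (ℤ.*-identityʳ (+ p)) (ℤ.*-identityˡ (+ suc l))) (sym (ℤ.pos-+ p (suc l))))
    (*-identityʳ l))

  module _ (λ' : ℚ) {p l : ℕ} (λ'≃ : toℚᵘ λ' ≃ mkℚᵘ (+ p) l) where

    1≤λ'⇒↧≤↥ : 1ℚ ℚ.≤ λ' → suc l ≤ p
    1≤λ'⇒↧≤↥ 1≤λ' = subst₂ _≤_ (+-identityʳ (suc l)) (*-identityʳ p)
      (Equivalence.to (≤⇔*≤* ℚᵘ.≃-refl λ'≃) 1≤λ')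

    *↧≤↥⇒≤λ' : ∀ c → c * suc l ≤ p → + c / 1 ℚ.≤ λ'
    *↧≤↥⇒≤λ' c ≤p = Equivalence.from (≤⇔*≤* (ℚ.toℚᵘ-fromℚᵘ (mkℚᵘ (+ c) 0)) λ'≃)
      (≤-trans ≤p (≤-reflexive (sym (*-identityʳ p))))

    -- avgDeg e 0 is 0 whatever e is, hence the hypothesis s ≡ 0 → e ≡ 0.
    λ'≰avgDeg⇒*≤* : ∀ e s → (s ≡ 0 → e ≡ 0) → ¬ λ' ℚ.≤ avgDeg e s → 2 * e * suc l ≤ p * s
    λ'≰avgDeg⇒*≤* e zero    e≡0 _ rewrite e≡0 refl = z≤n
    λ'≰avgDeg⇒*≤* e (suc s) _   λ'≰ =
      Equivalence.to (≤⇔*≤* (avgDeg-≃ e s) λ'≃) (ℚ.<⇒≤ (ℚ.≰⇒> λ'≰))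

    λ'≰dBetween⇒*≤* : ∀ {m n} (F : BipGraph m n) A B → ¬ λ' ℚ.≤ dBetween F A B →
                      2 * edgesBetween F A B * suc l ≤ p * (∣ A ∣ + ∣ B ∣)
    λ'≰dBetween⇒*≤* F A B = λ'≰avgDeg⇒*≤* (edgesBetween F A B) (∣ A ∣ + ∣ B ∣) λ s≡0 →
      n≤0⇒n≡0 (≤-trans (edgesBetween≤∣∣*∣∣ F A B) (≤-reflexive (cong (_* ∣ B ∣) (m+n≡0⇒m≡0 ∣ A ∣ s≡0))))

    avgDeg≤avgDeg*[λ'+1] : ∀ e e' s → suc l * e ≤ (p + suc l) * e' →
                           avgDeg e s ℚ.≤ avgDeg e' s ℚ.* (λ' ℚ.+ 1ℚ)
    avgDeg≤avgDeg*[λ'+1] e e' zero _ = ℚ.≤-reflexive (sym (ℚ.*-zeroˡ (λ' ℚ.+ 1ℚ)))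
    avgDeg≤avgDeg*[λ'+1] e e' (suc s) ≤ℕ = Equivalence.from (≤⇔*≤* (avgDeg-≃ e s) rhs≃)
      (subst₂ _≤_ (reshapeˡ e s l) (reshapeʳ e' s p l) (*-monoʳ-≤ (2 * suc s) ≤ℕ))
      where
      rhs≃ : toℚᵘ (avgDeg e' (suc s) ℚ.* (λ' ℚ.+ 1ℚ)) ≃ mkℚᵘ (+ (2 * e' * (p + suc l))) (l + s * suc l)
      rhs≃ = ℚᵘ.≃-trans (ℚ.toℚᵘ-homo-* (avgDeg e' (suc s)) (λ' ℚ.+ 1ℚ))
               (ℚᵘ.≃-trans (ℚᵘ.*-cong (avgDeg-≃ e' s)
                 (ℚᵘ.≃-trans (ℚ.toℚᵘ-homo-+ λ' 1ℚ) (ℚᵘ.≃-trans (ℚᵘ.+-cong λ'≃ ℚᵘ.≃-refl) (mkℚᵘ-+1 p l))))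
               (mkℚᵘ-* (2 * e') s (p + suc l) l))
      reshapeˡ : ∀ e s l → 2 * suc s * (suc l * e) ≡ 2 * e * suc (l + s * suc l)
      reshapeˡ = solve-∀
      reshapeʳ : ∀ e' s p l → 2 * suc s * ((p + suc l) * e') ≡ 2 * e' * (p + suc l) * suc s
      reshapeʳ = solve-∀

open import Data.Nat using (ℕ)
open import Data.Fin using (Fin)
open import Data.Fin.Subset using (Subset; _∈_; _∉_)
open import Data.Integer using (+_)
open import Data.Rational using (ℚ; _≤_; _+_; _*_; _/_; 1ℚ)
open import Data.Product using (Σ; _×_)
open import Data.Sum using (_⊎_)
open import Data.Bool using (true)
open import Relation.Nullary using (¬_)
open import Relation.Binary.PropositionalEquality using (_≡_)

import Data.Nat as ℕ
open import Data.Nat.DivMod using (m/n*n≤m)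
open import Data.Nat.Properties using (≤-trans; *-monoˡ-≤)
open import Data.Fin.Properties using (any?)
open import Data.Integer using (-[1+_])
open import Data.Product using (_,_)
open import Data.Rational using (mkℚ; *≤*)
open import Data.Rational.Properties using (_≤?_)
open import Data.Rational.Unnormalised.Properties using (≃-refl)
open import Data.Sum using (map)
open import Function.Base using (_∘_)
open import Relation.Nullary.Decidable using (toSum)
open NatArithmetic using (m≤2*[m/n]*n)
open AverageDegree

lemma2p3 : ∀ {m n : ℕ} (G : BipGraph m n) (λ' : ℚ) → 1ℚ ≤ λ' →
    (Σ (Fin n) λ v → Σ (Subset m) λ A' → Σ (Subset n) λ B' →
        (∀ a → a ∈ A' → G a v ≡ true) × v ∉ B' × λ' ≤ dBetween G A' B')
    ⊎ (Σ (BipGraph m n) λ H → H ⊆G G × d G ≤ d H * (λ' + 1ℚ) ×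
        (∀ x y → ¬ x ≡ y → (+ codeg H x y) / 1 ≤ λ'))
lemma2p3 G (mkℚ -[1+ _ ] _ _) (*≤* ())
lemma2p3 {m} {n} G λ'@(mkℚ (+ p) l _) 1≤λ' =
  map (λ (y , dense) → y , A y , B y , A⊆N y , y∉B y , dense)
      (λ noDense → H , H⊆G , density noDense , codegree)
      (toSum (any? λ y → λ' ≤? dBetween G (A y) (B y)))
  where
  open SaturatedSubgraph G (p ℕ./ ℕ.suc l)

  density : ¬ (Σ (Fin n) λ y → λ' ≤ dBetween G (A y) (B y)) → d G ≤ d H * (λ' + 1ℚ)
  density noDense = avgDeg≤avgDeg*[λ'+1] λ' ≃-refl (edges G) (edges H) (m ℕ.+ n)
    (sparse⇒q*edges≤[p+q]*edges p (ℕ.suc l) (m≤2*[m/n]*n p (ℕ.suc l) (1≤λ'⇒↧≤↥ λ' ≃-refl 1≤λ'))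
      λ y → λ'≰dBetween⇒*≤* λ' ≃-refl G (A y) (B y) (noDense ∘ (y ,_)))

  codegree : ∀ x y → ¬ x ≡ y → (+ codeg H x y) / 1 ≤ λ'
  codegree x y x≢y = *↧≤↥⇒≤λ' λ' ≃-refl (codeg H x y)
    (≤-trans (*-monoˡ-≤ (ℕ.suc l) (H-codegreeBounded x y x≢y)) (m/n*n≤m p (ℕ.suc l)))
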